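{- Let $G$ be a graph and $k$ a positive integer, and suppose $G$ has exactly $h$ large-vertices $v_1,\dots,v_h$ with $h<k$. Let $G_h$ be an $h$-reduced graph of $G$. Then $G$ has a $k$-matching if and only if $G_h$ has a $k$-matching.
   Context: Graphs are undirected. Relative to $k$, a vertex is a large-vertex if its degree is at least $2k$, and a small-vertex otherwise. A $k$-matching is a set of exactly $k$ edges no two sharing an endpoint. When $G$ has $h<k$ large-vertices, an $h$-reduced graph $G_h$ of $G$ is any graph obtained from $G$ as follows: (1) for each large-vertex $v_i$, choose arbitrarily $\deg(v_i)-2k$ edges of the form $[v_i,w_i]$ with $w_i$ a small-vertex, and delete these edges; (2) delete all vertices of degree $0$ in the resulting graph. -}

module Defs where

open import Data.Nat using (ℕ; zero; suc; _+_; _*_; _∸_; _≤_; _<_)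
open import Data.Bool using (Bool; true; false; _∧_; _∨_; not; T)
open import Data.Fin using (Fin)
open import Data.List using (List; length; filter; allFin)
open import Data.Product using (Σ; _×_; proj₁; proj₂)
open import Data.Sum using (_⊎_; inj₁; inj₂)
open import Relation.Binary.PropositionalEquality using (_≡_)
open import Relation.Nullary.Decidable using (T?; does)
open import Data.Nat.Properties using (_≤?_)
open import Function.Definitions using (Injective)
open import Function.Bundles using (_⇔_)

record Graph (n : ℕ) : Set where
  field
    V      : Fin n → Bool
    E      : Fin n → Fin n → Bool
    E-sym  : ∀ u v → E u v ≡ E v u
    E-irr  : ∀ v → E v v ≡ false
    E-in   : ∀ u v → E u v ≡ true → V u ≡ true
open Graph public

count : ∀ {n} → (Fin n → Bool) → ℕ
count {n} p = length (filter (λ x → T? (p x)) (allFin n))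

deg : ∀ {n} → Graph n → Fin n → ℕ
deg G v = count (E G v)

Large : ∀ {n} → ℕ → Graph n → Fin n → Set
Large k G v = (V G v ≡ true) × (2 * k ≤ deg G v)

Small : ∀ {n} → ℕ → Graph n → Fin n → Set
Small k G v = (V G v ≡ true) × (deg G v < 2 * k)

isLarge : ∀ {n} → ℕ → Graph n → Fin n → Bool
isLarge k G v = V G v ∧ does (2 * k ≤? deg G v)

numLarge : ∀ {n} → ℕ → Graph n → ℕ
numLarge k G = count (isLarge k G)

endpoint : ∀ {n k} → (Fin k → Fin n × Fin n) → Fin k ⊎ Fin k → Fin n
endpoint m (inj₁ i) = proj₁ (m i)
endpoint m (inj₂ i) = proj₂ (m i)

-- A k-matching: k edges m i = (a i , b i) of G, no two sharing an endpoint
-- (all 2k endpoints are pairwise distinct).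
record Matching {n : ℕ} (G : Graph n) (k : ℕ) : Set where
  field
    edge     : Fin k → Fin n × Fin n
    isEdge   : ∀ i → E G (proj₁ (edge i)) (proj₂ (edge i)) ≡ true
    disjoint : Injective _≡_ _≡_ (endpoint edge)

-- D v w = true means edge [v,w] is chosen for deletion by the large-vertex v.
-- (1) for each large-vertex v, exactly deg(v) - 2k edges [v,w] with w small
--     are chosen; the chosen edges are deleted;
-- (2) vertices of degree 0 in the resulting graph are deleted.
record IsReduced {n : ℕ} (k : ℕ) (G G' : Graph n) : Set where
  field
    D        : Fin n → Fin n → Bool
    D-ok     : ∀ v w → D v w ≡ true → Large k G v × Small k G w × (E G v w ≡ true)
    D-count  : ∀ v → Large k G v → count (D v) ≡ deg G v ∸ 2 * k
    E'-def   : ∀ u w → E G' u w ≡ (E G u w ∧ not (D u w ∨ D w u))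
    V'-def   : ∀ u → (V G' u ≡ true) ⇔ ((V G u ≡ true) × (0 < deg G' u))

module Submission where

-- An edge of G missing from Gh has a large endpoint v, and v keeps exactly 2k neighbours in Gh.
-- The other k − 1 edges of a k-matching cover only 2k − 2 vertices, so some Gh-neighbour u of v
-- is free, and replacing the edge by [v,u] repairs it without disturbing the other edges.
-- Repairing the edges one at a time turns a k-matching of G into one of Gh; conversely, Gh is a
-- subgraph of G.

open import Defs
open import Data.Nat using (ℕ; zero; suc; _+_; _*_; _∸_; _≤_; _<_; s≤s)
open import Data.Nat.Properties
  using (module ≤-Reasoning; ≤-refl; ≤-trans; ≤-pred; m≤n⇒m≤1+n; <⇒≱; +-suc; *-monoʳ-<;
         +-cancelʳ-≡; m+[n∸m]≡n)
open import Data.Bool using (Bool; true; false; _∧_; not; if_then_else_)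
open import Data.Bool.Properties using (∧-zeroʳ; ∨-identityʳ)
open import Data.Fin using (Fin; zero; suc; _≟_; punchIn; punchOut)
open import Data.Fin.Properties using (punchIn-punchOut)
open import Data.List using (List; []; _∷_; length; filter; allFin; map; tabulate)
open import Data.List.Properties using (map-tabulate)
open import Data.List.Membership.Propositional using (_∈_; _∉_)
open import Data.List.Membership.Propositional.Properties using (∈-allFin)
open import Data.List.Relation.Unary.Any using (here; there)
open import Data.Product using (Σ; ∃; _×_; _,_; proj₁; proj₂)
open import Data.Sum using (_⊎_; inj₁; inj₂; reduce; swap)
open import Data.Sum.Properties using (≡-dec)
open import Data.Vec.Functional using (updateAt)
open import Data.Vec.Functional.Properties using (updateAt-updates; updateAt-minimal)
open import Function.Definitions using (Injective)
open import Function.Bundles using (_⇔_; mk⇔)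
open import Function using (_∘_; id; const)
open import Relation.Binary.Definitions using (DecidableEquality)
open import Relation.Binary.PropositionalEquality
open import Relation.Nullary using (yes; no; does; contradiction)
open import Relation.Nullary.Decidable using (T?)

length-filter-map : ∀ {A B : Set} (p : B → Bool) (f : A → B) (xs : List A) →
                    length (filter (T? ∘ p) (map f xs)) ≡ length (filter (T? ∘ p ∘ f) xs)
length-filter-map p f []       = refl
length-filter-map p f (x ∷ xs) with p (f x)
... | true  = cong suc (length-filter-map p f xs)
... | false = length-filter-map p f xs

length-filter-tabulate-suc : ∀ {n} (p : Fin (suc n) → Bool) →
                             length (filter (T? ∘ p) (tabulate suc)) ≡ count (p ∘ suc)
length-filter-tabulate-suc {n} p =
  trans (cong (length ∘ filter (T? ∘ p)) (sym (map-tabulate id suc)))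
        (length-filter-map p suc (allFin n))

count-suc : ∀ {n} (p : Fin (suc n) → Bool) →
            count p ≡ (if p zero then suc else id) (count (p ∘ suc))
count-suc p with p zero
... | true  = cong suc (length-filter-tabulate-suc p)
... | false = length-filter-tabulate-suc p

count-cong : ∀ {n} {p q : Fin n → Bool} → (∀ x → p x ≡ q x) → count p ≡ count q
count-cong {zero}          p≗q = refl
count-cong {suc n} {p} {q} p≗q = begin
  count p                                        ≡⟨ count-suc p ⟩
  (if p zero then suc else id) (count (p ∘ suc)) ≡⟨ cong₂ (λ b m → (if b then suc else id) m)
                                                          (p≗q zero) (count-cong (p≗q ∘ suc)) ⟩
  (if q zero then suc else id) (count (q ∘ suc)) ≡⟨ count-suc q ⟨
  count q                                        ∎
  where open ≡-Reasoning

count-split : ∀ {n} (p q : Fin n → Bool) →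
              count p ≡ count (λ x → p x ∧ not (q x)) + count (λ x → p x ∧ q x)
count-split {zero}  p q = refl
count-split {suc n} p q
  rewrite count-suc p | count-suc (λ x → p x ∧ not (q x)) | count-suc (λ x → p x ∧ q x)
  with p zero | q zero | count-split (p ∘ suc) (q ∘ suc)
... | true  | true  | ih = trans (cong suc ih) (sym (+-suc _ _))
... | true  | false | ih = cong suc ih
... | false | _     | ih = ih

count-remove : ∀ {n} (p : Fin n → Bool) (a : Fin n) →
               count p ≤ suc (count (λ x → not (does (x ≟ a)) ∧ p x))
count-remove {suc n} p a rewrite count-suc p | count-suc (λ x → not (does (x ≟ a)) ∧ p x)
  with a | p zero
... | zero  | true  = ≤-refl
... | zero  | false = m≤n⇒m≤1+n ≤-refl
... | suc a | true  = s≤s (count-remove (p ∘ suc) a)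
... | suc a | false = count-remove (p ∘ suc) a

count-pos : ∀ {n} (p : Fin n → Bool) → 0 < count p → ∃ λ x → p x ≡ true
count-pos {suc n} p pos rewrite count-suc p with p zero in p0
... | true  = zero , p0
... | false with count-pos (p ∘ suc) pos
...   | x , px = suc x , px

length<count⇒∃∉ : ∀ {n} (p : Fin n → Bool) (xs : List (Fin n)) → length xs < count p →
                  ∃ λ x → p x ≡ true × x ∉ xs
length<count⇒∃∉ p []       lt with count-pos p lt
... | x , px = x , px , λ ()
length<count⇒∃∉ p (a ∷ xs) lt
  with length<count⇒∃∉ (λ x → not (does (x ≟ a)) ∧ p x) xs (≤-pred (≤-trans lt (count-remove p a)))
... | x , px , x∉xs with x ≟ a
...   | no x≢a = x , px , λ { (here x≡a) → x≢a x≡a ; (there x∈xs) → x∉xs x∈xs }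

Injective-updated : ∀ {A B : Set} {f g : A → B} {a : A} → DecidableEquality A →
                    Injective _≡_ _≡_ f → (∀ x → x ≢ a → g x ≡ f x) → (∀ x → x ≢ a → f x ≢ g a) →
                    Injective _≡_ _≡_ g
Injective-updated {f = f} {g} {a} _≟ᴬ_ f-inj g≗f fresh {x} {y} gx≡gy with x ≟ᴬ a | y ≟ᴬ a
... | yes refl | yes refl = refl
... | yes refl | no  y≢a  = contradiction (trans (sym (g≗f y y≢a)) (sym gx≡gy)) (fresh y y≢a)
... | no  x≢a  | yes refl = contradiction (trans (sym (g≗f x x≢a)) gx≡gy) (fresh x x≢a)
... | no  x≢a  | no  y≢a  = f-inj (trans (sym (g≗f x x≢a)) (trans gx≡gy (g≗f y y≢a)))

_∈ᴱ_ : ∀ {n} → Fin n × Fin n → Graph n → Set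
e ∈ᴱ G = E G (proj₁ e) (proj₂ e) ≡ true

transferMatching : ∀ {n k} {G H : Graph n} (M : Matching G k) →
                   (∀ i → Matching.edge M i ∈ᴱ H) → Matching H k
transferMatching M inH = record { edge = edge ; isEdge = inH ; disjoint = disjoint }
  where open Matching M

endpoints : ∀ {n k} → (Fin k → Fin n × Fin n) → List (Fin n)
endpoints {k = zero}  f = []
endpoints {k = suc k} f = proj₁ (f zero) ∷ proj₂ (f zero) ∷ endpoints (f ∘ suc)

length-endpoints : ∀ {n k} (f : Fin k → Fin n × Fin n) → length (endpoints f) ≡ 2 * k
length-endpoints {k = zero}  f = refl
length-endpoints {k = suc k} f =
  cong suc (trans (cong suc (length-endpoints (f ∘ suc))) (sym (+-suc k (k + 0))))

endpoint∈endpoints : ∀ {n k} (f : Fin k → Fin n × Fin n) c → endpoint f c ∈ endpoints f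
endpoint∈endpoints f (inj₁ zero)    = here refl
endpoint∈endpoints f (inj₂ zero)    = there (here refl)
endpoint∈endpoints f (inj₁ (suc i)) = there (there (endpoint∈endpoints (f ∘ suc) (inj₁ i)))
endpoint∈endpoints f (inj₂ (suc i)) = there (there (endpoint∈endpoints (f ∘ suc) (inj₂ i)))

endpoint∈endpoints-punchIn : ∀ {n k} (f : Fin (suc k) → Fin n × Fin n) i c → reduce c ≢ i →
                             endpoint f c ∈ endpoints (f ∘ punchIn i)
endpoint∈endpoints-punchIn f i (inj₁ j) j≢i =
  subst (_∈ endpoints (f ∘ punchIn i)) (cong (proj₁ ∘ f) (punchIn-punchOut (j≢i ∘ sym)))
        (endpoint∈endpoints (f ∘ punchIn i) (inj₁ (punchOut (j≢i ∘ sym))))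
endpoint∈endpoints-punchIn f i (inj₂ j) j≢i =
  subst (_∈ endpoints (f ∘ punchIn i)) (cong (proj₂ ∘ f) (punchIn-punchOut (j≢i ∘ sym)))
        (endpoint∈endpoints (f ∘ punchIn i) (inj₂ (punchOut (j≢i ∘ sym))))

orient : ∀ {k} {A : Set} → Fin k ⊎ Fin k → A → A → A × A
orient (inj₁ _) v u = v , u
orient (inj₂ _) v u = u , v

orient-∈ᴱ : ∀ {n k} (G : Graph n) (c : Fin k ⊎ Fin k) {v u} → (v , u) ∈ᴱ G → orient c v u ∈ᴱ G
orient-∈ᴱ G (inj₁ _)         vu = vu
orient-∈ᴱ G (inj₂ _) {v} {u} vu = trans (E-sym G u v) vu

exchangeEdge : ∀ {n k} → (Fin k → Fin n × Fin n) → Fin k ⊎ Fin k → Fin n → Fin k → Fin n × Fin n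
exchangeEdge f c u = updateAt f (reduce c) (const (orient c (endpoint f c) u))

reduce≡⇒≡⊎≡swap : ∀ {k} {c c′ : Fin k ⊎ Fin k} → reduce c′ ≡ reduce c → c′ ≡ c ⊎ c′ ≡ swap c
reduce≡⇒≡⊎≡swap {c = inj₁ _} {inj₁ _} refl = inj₁ refl
reduce≡⇒≡⊎≡swap {c = inj₁ _} {inj₂ _} refl = inj₂ refl
reduce≡⇒≡⊎≡swap {c = inj₂ _} {inj₁ _} refl = inj₂ refl
reduce≡⇒≡⊎≡swap {c = inj₂ _} {inj₂ _} refl = inj₁ refl

module _ {n k} (f : Fin k → Fin n × Fin n) (u : Fin n) where

  endpoint-exchangeEdge-swap : ∀ c → endpoint (exchangeEdge f c u) (swap c) ≡ u
  endpoint-exchangeEdge-swap (inj₁ i) = cong proj₂ (updateAt-updates i f)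
  endpoint-exchangeEdge-swap (inj₂ i) = cong proj₁ (updateAt-updates i f)

  endpoint-exchangeEdge-self : ∀ c → endpoint (exchangeEdge f c u) c ≡ endpoint f c
  endpoint-exchangeEdge-self (inj₁ i) = cong proj₁ (updateAt-updates i f)
  endpoint-exchangeEdge-self (inj₂ i) = cong proj₂ (updateAt-updates i f)

  endpoint-exchangeEdge : ∀ c c′ → c′ ≢ swap c → endpoint (exchangeEdge f c u) c′ ≡ endpoint f c′
  endpoint-exchangeEdge c c′ c′≢c̃ with reduce c′ ≟ reduce c
  ... | yes same-edge with reduce≡⇒≡⊎≡swap {c = c} {c′} same-edge
  ...   | inj₁ refl = endpoint-exchangeEdge-self c
  ...   | inj₂ c′≡c̃ = contradiction c′≡c̃ c′≢c̃
  endpoint-exchangeEdge c (inj₁ j) _ | no j≢i = cong proj₁ (updateAt-minimal j (reduce c) f j≢i)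
  endpoint-exchangeEdge c (inj₂ j) _ | no j≢i = cong proj₂ (updateAt-minimal j (reduce c) f j≢i)

∈ᴱ⇒≢ : ∀ {n} (G : Graph n) {v u} → (v , u) ∈ᴱ G → v ≢ u
∈ᴱ⇒≢ G {v} vv refl with () ← trans (sym (E-irr G v)) vv

module _ {n k} {G : Graph n} (M : Matching G (suc k)) where
  open Matching M

  exchange : ∀ c {u} → (endpoint edge c , u) ∈ᴱ G → u ∉ endpoints (edge ∘ punchIn (reduce c)) →
             Matching G (suc k)
  exchange c {u} vu∈G u∉others = record
    { edge     = exchangeEdge edge c u
    ; isEdge   = isEdge′
    ; disjoint = Injective-updated (≡-dec _≟_ _≟_) disjoint (endpoint-exchangeEdge edge u c)
                   (λ c′ c′≢c̃ eq → u-fresh c′ c′≢c̃ (trans eq (endpoint-exchangeEdge-swap edge u c)))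
    }
    where
    isEdge′ : ∀ j → exchangeEdge edge c u j ∈ᴱ G
    isEdge′ j with j ≟ reduce c
    ... | yes refl = subst (_∈ᴱ G) (sym (updateAt-updates j edge)) (orient-∈ᴱ G c vu∈G)
    ... | no  j≢i  = subst (_∈ᴱ G) (sym (updateAt-minimal j _ edge j≢i)) (isEdge j)

    u-fresh : ∀ c′ → c′ ≢ swap c → endpoint edge c′ ≢ u
    u-fresh c′ c′≢c̃ with reduce c′ ≟ reduce c
    ... | no other-edge = λ { refl → u∉others (endpoint∈endpoints-punchIn edge (reduce c) c′ other-edge) }
    ... | yes same-edge with reduce≡⇒≡⊎≡swap {c = c} {c′} same-edge
    ...   | inj₁ refl = ∈ᴱ⇒≢ G vu∈G
    ...   | inj₂ c′≡c̃ = contradiction c′≡c̃ c′≢c̃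

module Reduced {n k} {G Gh : Graph n} (R : IsReduced k G Gh) where
  open IsReduced R

  E-reduced⇒E : ∀ {a b} → (a , b) ∈ᴱ Gh → (a , b) ∈ᴱ G
  E-reduced⇒E {a} {b} ab with E G a b | E'-def a b
  ... | true  | _   = refl
  ... | false | ab≡false with () ← trans (sym ab≡false) ab

  kept-or-large : ∀ {a b} → (a , b) ∈ᴱ G → (a , b) ∈ᴱ Gh ⊎ (Large k G a ⊎ Large k G b)
  kept-or-large {a} {b} ab with D a b in dab | D b a in dba
  ... | true  | _     = inj₂ (inj₁ (proj₁ (D-ok a b dab)))
  ... | false | true  = inj₂ (inj₂ (proj₁ (D-ok b a dba)))
  ... | false | false rewrite E'-def a b | dab | dba | ab = inj₁ refl

  E-reduced-large : ∀ {v} → Large k G v → ∀ w → E Gh v w ≡ E G v w ∧ not (D v w)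
  E-reduced-large {v} (_ , large) w with D w v in dwv
  ... | true  = contradiction large (<⇒≱ (proj₂ (proj₁ (proj₂ (D-ok w v dwv)))))
  ... | false rewrite E'-def v w | dwv = cong (λ b → E G v w ∧ not b) (∨-identityʳ (D v w))

  E∧D≡D : ∀ v w → E G v w ∧ D v w ≡ D v w
  E∧D≡D v w with D v w in dvw
  ... | true  rewrite proj₂ (proj₂ (D-ok v w dvw)) = refl
  ... | false = ∧-zeroʳ (E G v w)

  deg-reduced-large : ∀ {v} → Large k G v → deg Gh v ≡ 2 * k
  deg-reduced-large {v} L@(_ , large) = +-cancelʳ-≡ (deg G v ∸ 2 * k) (deg Gh v) (2 * k) (begin
    deg Gh v + (deg G v ∸ 2 * k)              ≡⟨ cong₂ _+_ (count-cong (E-reduced-large L)) (sym (D-count v L)) ⟩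
    kept + count (D v)                        ≡⟨ cong (kept +_) (count-cong (E∧D≡D v)) ⟨
    kept + count (λ w → E G v w ∧ D v w)      ≡⟨ count-split (E G v) (D v) ⟨
    deg G v                                   ≡⟨ m+[n∸m]≡n large ⟨
    2 * k + (deg G v ∸ 2 * k)                 ∎)
    where
    open ≡-Reasoning
    kept = count (λ w → E G v w ∧ not (D v w))

module Repair {n k} {G Gh : Graph n} (R : IsReduced (suc k) G Gh) where
  open Reduced R
  open Matching

  RepairedAt : Matching G (suc k) → Fin (suc k) → Set
  RepairedAt M i = Σ (Matching G (suc k)) λ M′ →
                   edge M′ i ∈ᴱ Gh × (∀ j → j ≢ i → edge M′ j ≡ edge M j)

  repairAt : (M : Matching G (suc k)) (c : Fin (suc k) ⊎ Fin (suc k)) →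
             Large (suc k) G (endpoint (edge M) c) → RepairedAt M (reduce c)
  repairAt M c large with length<count⇒∃∉ (E Gh v) (endpoints (edge M ∘ punchIn (reduce c))) fewer
    where
    v = endpoint (edge M) c
    fewer : length (endpoints (edge M ∘ punchIn (reduce c))) < deg Gh v
    fewer = begin-strict
      length (endpoints (edge M ∘ punchIn (reduce c))) ≡⟨ length-endpoints (edge M ∘ punchIn (reduce c)) ⟩
      2 * k                                            <⟨ *-monoʳ-< 2 ≤-refl ⟩
      2 * suc k                                        ≡⟨ deg-reduced-large large ⟨
      deg Gh v                                         ∎
      where open ≤-Reasoning
  ... | u , vu∈Gh , u∉others =
    exchange M c (E-reduced⇒E vu∈Gh) u∉others ,
    subst (_∈ᴱ Gh) (sym (updateAt-updates (reduce c) (edge M))) (orient-∈ᴱ Gh c vu∈Gh) ,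
    λ j j≢i → updateAt-minimal j (reduce c) (edge M) j≢i

  repair : (M : Matching G (suc k)) (i : Fin (suc k)) → RepairedAt M i
  repair M i with kept-or-large (isEdge M i)
  ... | inj₁ kept          = M , kept , λ _ _ → refl
  ... | inj₂ (inj₁ large₁) = repairAt M (inj₁ i) large₁
  ... | inj₂ (inj₂ large₂) = repairAt M (inj₂ i) large₂

  repairAll : Matching G (suc k) → (is : List (Fin (suc k))) →
              Σ (Matching G (suc k)) λ M′ → ∀ j → j ∈ is → edge M′ j ∈ᴱ Gh
  repairAll M []       = M , λ _ ()
  repairAll M (i ∷ is) with repairAll M is
  ... | M₁ , good with repair M₁ i
  ...   | M₂ , fixed , unchanged = M₂ , good′
    where
    good′ : ∀ j → j ∈ i ∷ is → edge M₂ j ∈ᴱ Gh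
    good′ j (here refl)  = fixed
    good′ j (there j∈is) with j ≟ i
    ... | yes refl = fixed
    ... | no  j≢i  = subst (_∈ᴱ Gh) (sym (unchanged j j≢i)) (good j j∈is)

  reducedMatching : Matching G (suc k) → Matching Gh (suc k)
  reducedMatching M with repairAll M (allFin (suc k))
  ... | M′ , good = transferMatching M′ (λ j → good j (∈-allFin j))

lemma3p2 : (n k h : ℕ) (G Gh : Graph n) → 0 < k → numLarge k G ≡ h → h < k →
           IsReduced k G Gh → Matching G k ⇔ Matching Gh k
lemma3p2 n zero    h G Gh () _ _ _
lemma3p2 n (suc k) h G Gh _  _ _ R =
  mk⇔ reducedMatching (λ M → transferMatching M (E-reduced⇒E ∘ Matching.isEdge M))
  where open Repair R
        open Reduced R
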